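{- (Abstraction is not absorbent.) Let $g:\mathbb N\to\mathbb N$ satisfy $h<g(h)$ for all $h$. For every environment $C$, variable $x$ and terms $V,T,U_1,U_2$: if $C\vdash_g\lambda x{:}V.T:U_1$, $C.\lambda x{:}V\vdash_g T:U_2$ and $x\notin\mathrm{FV}(U_2)$, then $C\vdash U_1\Leftrightarrow U_2$ does not hold.
   Context: Terms of $\lambda\delta$: $T ::= \ast h \mid x \mid \lambda x{:}W.\,T \mid \delta x{=}V.\,T \mid \mathrm{appl}(V,T) \mid \mathrm{cast}(W,T)$ ($h\in\mathbb N$, $x$ a variable); $\ast h$ is a sort, $\lambda x{:}W.T$ abstraction over type $W$, $\delta x{=}V.T$ the abbreviation "let $x=V$ in $T$", $\mathrm{appl}(V,T)$ application of $T$ to argument $V$, $\mathrm{cast}(W,T)$ $T$ annotated with type $W$. In $\lambda x{:}W.T$, $\delta x{=}V.T$, $x$ is bound in $T$ only; $\mathrm{FV}(T)$ free variables; terms up to renaming of bound variables with bound and free names disjoint. Environments: $E ::= \ast h \mid \lambda x{:}W.E \mid \delta x{=}V.E \mid \mathrm{appl}(V,E)\mid\mathrm{cast}(W,E)$. $E.\lambda x{:}W$ (resp. $E.\delta x{=}V$) is $E$ with its terminal sort $\ast h$ replaced by $\lambda x{:}W.\ast h$ (resp. $\delta x{=}V.\ast h$). $E=C_1\cdot\beta\cdot C_2$, for an item $\beta$ of the form $\lambda x{:}W$ or $\delta x{=}V$, means $E$ is obtained from the environment $C_1$ by replacing its terminal sort with $\beta.C_2$ for some environment $C_2$. Strict substitution: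 $T[x:=^+W]\,T'$ iff $x\notin\mathrm{FV}(W)$, $x\in\mathrm{FV}(T)$ and $T'$ arises from $T$ by replacing a nonempty set of free occurrences of $x$ by $W$. Environment-free parallel reduction $\to_0$: least relation closed under (refl) $T\to_0T$; (compatibility) if $A_1\to_0A_2$, $T_1\to_0T_2$ then $\lambda x{:}A_1.T_1\to_0\lambda x{:}A_2.T_2$, $\delta x{=}A_1.T_1\to_0\delta x{=}A_2.T_2$, $\mathrm{appl}(A_1,T_1)\to_0\mathrm{appl}(A_2,T_2)$, $\mathrm{cast}(A_1,T_1)\to_0\mathrm{cast}(A_2,T_2)$; ($\beta$) if $V_1\to_0V_2$, $T_1\to_0T_2$ then $\mathrm{appl}(V_1,\lambda x{:}W.T_1)\to_0\delta x{=}V_2.T_2$; ($\delta$) if $V_1\to_0V_2$, $T_1\to_0T_2$, $T_2[x:=^+V_2]T$ then $\delta x{=}V_1.T_1\to_0\delta x{=}V_2.T$; ($\zeta$) if $T_1\to_0T_2$, $x\notin\mathrm{FV}(T_1)$ then $\delta x{=}V.T_1\to_0T_2$; ($\tau$) if $T_1\to_0T_2$ then $\mathrm{cast}(W,T_1)\to_0T_2$; ($\upsilon$) if $V_1\to_0V_3$, $V_2\to_0V_4$, $T_1\to_0T_2$ then $\mathrm{appl}(V_1,\delta x{=}V_2.T_1)\to_0\delta x{=}V_4.\mathrm{appl}(V_3,T_2)$. $E\vdash T_1\to T_2$ iff $T_1\to_0T_2$, or $E=C_1\cdot\delta x{=}V\cdot C_2$, $T_1\to_0T'$, $T'[x:=^+V]T_2$.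 Conversion $E\vdash T_1\Leftrightarrow T_2$ is its symmetric and transitive closure. Native type assignment $E\vdash_g T:U$ is the least relation closed under: (sort) $E\vdash_g\ast h:\ast g(h)$; (def) if $E=C_1\cdot\delta x{=}V\cdot C_2$ and $C_1\vdash_g V:W$ then $E\vdash_g x:W$; (decl) if $E=C_1\cdot\lambda x{:}W\cdot C_2$ and $C_1\vdash_g W:V$ then $E\vdash_g x:W$; (abbr) if $E\vdash_g V:W$ and $E.\delta x{=}V\vdash_g T:U$ then $E\vdash_g\delta x{=}V.T:\delta x{=}V.U$; (abst) if $E\vdash_g W:V$ and $E.\lambda x{:}W\vdash_g T:U$ then $E\vdash_g\lambda x{:}W.T:\lambda x{:}W.U$; (appl) if $E\vdash_g V:W$ and $E\vdash_g T:\lambda x{:}W.U$ then $E\vdash_g\mathrm{appl}(V,T):\mathrm{appl}(V,\lambda x{:}W.U)$; (cast) if $E\vdash_g T:W$ and $E\vdash_g W:V$ then $E\vdash_g\mathrm{cast}(W,T):\mathrm{cast}(V,W)$; (conv) if $E\vdash_g U_2:W$, $E\vdash_g T:U_1$ and $E\vdash U_1\Leftrightarrow U_2$ then $E\vdash_g T:U_2$. -}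

module Defs where

-- The λδ calculus, with variables represented by de Bruijn indices
-- (terms up to renaming of bound variables).

open import Data.Nat using (ℕ; zero; suc; _+_; _<ᵇ_)
open import Data.Bool using (if_then_else_)
open import Relation.Nullary using (¬_)
open import Data.Product using (Σ; _×_)

infixl 5 _∙_

data Term : Set where
  ⋆    : ℕ → Term
  #    : ℕ → Term
  abst : Term → Term → Term   -- abst W T  =  λx:W.T   (x = index 0 in T)
  abbr : Term → Term → Term   -- abbr V T  =  δx=V.T   (x = index 0 in T)
  appl : Term → Term → Term
  cast : Term → Term → Term

shift : ℕ → ℕ → Term → Term
shift d c (⋆ h)      = ⋆ h
shift d c (# i)      = if i <ᵇ c then # i else # (i + d)
shift d c (abst W T) = abst (shift d c W) (shift d (suc c) T)
shift d c (abbr V T) = abbr (shift d c V) (shift d (suc c) T)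
shift d c (appl V T) = appl (shift d c V) (shift d c T)
shift d c (cast W T) = cast (shift d c W) (shift d c T)

data Occ : ℕ → Term → Set where
  here  : ∀ {i} → Occ i (# i)
  abst₁ : ∀ {i A B} → Occ i A → Occ i (abst A B)
  abst₂ : ∀ {i A B} → Occ (suc i) B → Occ i (abst A B)
  abbr₁ : ∀ {i A B} → Occ i A → Occ i (abbr A B)
  abbr₂ : ∀ {i A B} → Occ (suc i) B → Occ i (abbr A B)
  appl₁ : ∀ {i A B} → Occ i A → Occ i (appl A B)
  appl₂ : ∀ {i A B} → Occ i B → Occ i (appl A B)
  cast₁ : ∀ {i A B} → Occ i A → Occ i (cast A B)
  cast₂ : ∀ {i A B} → Occ i B → Occ i (cast A B)

data PSub : ℕ → Term → Term → Term → ℕ → Set where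
  sortS : ∀ {i W h} → PSub i W (⋆ h) (⋆ h) 0
  keep  : ∀ {i W j} → PSub i W (# j) (# j) 0
  repl  : ∀ {i W} → PSub i W (# i) W 1
  abstS : ∀ {i W A A' B B' m n} → PSub i W A A' m →
          PSub (suc i) (shift 1 0 W) B B' n → PSub i W (abst A B) (abst A' B') (m + n)
  abbrS : ∀ {i W A A' B B' m n} → PSub i W A A' m →
          PSub (suc i) (shift 1 0 W) B B' n → PSub i W (abbr A B) (abbr A' B') (m + n)
  applS : ∀ {i W A A' B B' m n} → PSub i W A A' m →
          PSub i W B B' n → PSub i W (appl A B) (appl A' B') (m + n)
  castS : ∀ {i W A A' B B' m n} → PSub i W A A' m →
          PSub i W B B' n → PSub i W (cast A B) (cast A' B') (m + n)

StrictSubst : ℕ → Term → Term → Term → Set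
StrictSubst x W T T' = ¬ Occ x W × Occ x T × Σ ℕ (λ n → PSub x W T T' (suc n))

infix 4 _⇒₀_
data _⇒₀_ : Term → Term → Set where
  refl₀ : ∀ {T} → T ⇒₀ T
  abstC : ∀ {A₁ A₂ T₁ T₂} → A₁ ⇒₀ A₂ → T₁ ⇒₀ T₂ → abst A₁ T₁ ⇒₀ abst A₂ T₂
  abbrC : ∀ {A₁ A₂ T₁ T₂} → A₁ ⇒₀ A₂ → T₁ ⇒₀ T₂ → abbr A₁ T₁ ⇒₀ abbr A₂ T₂
  applC : ∀ {A₁ A₂ T₁ T₂} → A₁ ⇒₀ A₂ → T₁ ⇒₀ T₂ → appl A₁ T₁ ⇒₀ appl A₂ T₂
  castC : ∀ {A₁ A₂ T₁ T₂} → A₁ ⇒₀ A₂ → T₁ ⇒₀ T₂ → cast A₁ T₁ ⇒₀ cast A₂ T₂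
  β     : ∀ {V₁ V₂ W T₁ T₂} → V₁ ⇒₀ V₂ → T₁ ⇒₀ T₂ →
          appl V₁ (abst W T₁) ⇒₀ abbr V₂ T₂
  δ     : ∀ {V₁ V₂ T₁ T₂ T} → V₁ ⇒₀ V₂ → T₁ ⇒₀ T₂ →
          StrictSubst 0 (shift 1 0 V₂) T₂ T →
          abbr V₁ T₁ ⇒₀ abbr V₂ T
  -- x ∉ FV(body): the body is the weakening of a term T₁ of the outer scope
  ζ     : ∀ {V T₁ T₂} → T₁ ⇒₀ T₂ → abbr V (shift 1 0 T₁) ⇒₀ T₂
  τ     : ∀ {W T₁ T₂} → T₁ ⇒₀ T₂ → cast W T₁ ⇒₀ T₂
  υ     : ∀ {V₁ V₂ V₃ V₄ T₁ T₂} → V₁ ⇒₀ V₃ → V₂ ⇒₀ V₄ → T₁ ⇒₀ T₂ →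
          appl V₁ (abbr V₂ T₁) ⇒₀ abbr V₄ (appl (shift 1 0 V₃) T₂)

-- Environments.  ⋆E h is the environment ∗h; E ∙ β is E with its terminal
-- sort ∗h replaced by β.∗h (so β is the innermost item).
data Item : Set where
  λI    : Term → Item
  δI    : Term → Item
  applI : Term → Item
  castI : Term → Item

data Env : Set where
  ⋆E  : ℕ → Env
  _∙_ : Env → Item → Env

setSort : ℕ → Env → Env
setSort h (⋆E _)  = ⋆E h
setSort h (E ∙ b) = setSort h E ∙ b

_·[_]·_ : Env → Item → Env → Env
C₁ ·[ b ]· ⋆E h    = setSort h C₁ ∙ b
C₁ ·[ b ]· (C ∙ i) = (C₁ ·[ b ]· C) ∙ i

binders : Env → ℕ
binders (⋆E _)        = 0
binders (E ∙ λI _)    = suc (binders E)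
binders (E ∙ δI _)    = suc (binders E)
binders (E ∙ applI _) = binders E
binders (E ∙ castI _) = binders E

data _⊢_⇒_ : Env → Term → Term → Set where
  free  : ∀ {E T₁ T₂} → T₁ ⇒₀ T₂ → E ⊢ T₁ ⇒ T₂
  unfold : ∀ {C₁ V C₂ T₁ T' T₂} → T₁ ⇒₀ T' →
           StrictSubst (binders C₂) (shift (suc (binders C₂)) 0 V) T' T₂ →
           (C₁ ·[ δI V ]· C₂) ⊢ T₁ ⇒ T₂

data _⊢_⇔_ : Env → Term → Term → Set where
  step  : ∀ {E T₁ T₂} → E ⊢ T₁ ⇒ T₂ → E ⊢ T₁ ⇔ T₂
  symm  : ∀ {E T₁ T₂} → E ⊢ T₁ ⇔ T₂ → E ⊢ T₂ ⇔ T₁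
  trans : ∀ {E T₁ T₂ T₃} → E ⊢ T₁ ⇔ T₂ → E ⊢ T₂ ⇔ T₃ → E ⊢ T₁ ⇔ T₃

data _⊢[_]_∶_ : Env → (ℕ → ℕ) → Term → Term → Set where
  sortT : ∀ {g E h} → E ⊢[ g ] ⋆ h ∶ ⋆ (g h)
  defT  : ∀ {g C₁ V C₂ W} → C₁ ⊢[ g ] V ∶ W →
          (C₁ ·[ δI V ]· C₂) ⊢[ g ] # (binders C₂) ∶ shift (suc (binders C₂)) 0 W
  declT : ∀ {g C₁ W C₂ V} → C₁ ⊢[ g ] W ∶ V →
          (C₁ ·[ λI W ]· C₂) ⊢[ g ] # (binders C₂) ∶ shift (suc (binders C₂)) 0 W
  abbrT : ∀ {g E V W T U} → E ⊢[ g ] V ∶ W → (E ∙ δI V) ⊢[ g ] T ∶ U →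
          E ⊢[ g ] abbr V T ∶ abbr V U
  abstT : ∀ {g E W V T U} → E ⊢[ g ] W ∶ V → (E ∙ λI W) ⊢[ g ] T ∶ U →
          E ⊢[ g ] abst W T ∶ abst W U
  applT : ∀ {g E V W T U} → E ⊢[ g ] V ∶ W → E ⊢[ g ] T ∶ abst W U →
          E ⊢[ g ] appl V T ∶ appl V (abst W U)
  castT : ∀ {g E T W V} → E ⊢[ g ] T ∶ W → E ⊢[ g ] W ∶ V →
          E ⊢[ g ] cast W T ∶ cast V W
  convT : ∀ {g E U₁ U₂ W T} → E ⊢[ g ] U₂ ∶ W → E ⊢[ g ] T ∶ U₁ →
          E ⊢ U₁ ⇔ U₂ → E ⊢[ g ] T ∶ U₂

-- Erase every term to a simple kind: sorts have the base kind ι, λx:W.T has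
-- kind κ(W) ⇾ κ(T), an application has the result kind of its function, and
-- abbreviations and casts have the kind of their body. A typed term and its
-- type always have the same kind, and convertible terms cannot have different
-- kinds, because parallel reduction (which also unfolds the definitions of the
-- environment) is confluent and preserves kinds. Under the hypotheses U₁ has
-- kind κ(V) ⇾ κ(T) while U₂, like T, has kind κ(T); so U₁ ⇔ U₂ would give
-- κ(V) ⇾ κ(T) = κ(T), which is impossible.

module Submission where

open import Defs hiding (trans)
open import Data.Bool using (true; false; if_then_else_)
open import Data.Maybe using (Maybe; just; nothing; map; fromMaybe)
open import Data.Maybe.Properties using (just-injective; map-just)
open import Data.Nat using (ℕ; zero; suc; _+_; _<_; _<ᵇ_)
open import Data.Nat.Properties using (+-comm; +-suc)
open import Data.Product using (∃; ∃₂; _×_; _,_)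
open import Function using (_∘_)
open import Relation.Binary.Construct.Closure.Equivalence using (EqClosure; gmap; symmetric; return)
open import Relation.Binary.Construct.Closure.ReflexiveTransitive using (Star; ε; _◅_; _◅◅_)
open import Relation.Binary.Construct.Closure.Symmetric using (fwd; bwd)
open import Relation.Binary.PropositionalEquality
  using (_≡_; _≢_; _≗_; refl; sym; trans; cong; cong₂; cong-app; module ≡-Reasoning)
open import Relation.Nullary using (¬_; Dec; yes; no; contradiction)

-- Renaming and substitution

⇑ʳ : (ℕ → ℕ) → ℕ → ℕ
⇑ʳ ρ zero    = zero
⇑ʳ ρ (suc i) = suc (ρ i)

ren : (ℕ → ℕ) → Term → Term
ren ρ (⋆ h)      = ⋆ h
ren ρ (# i)      = # (ρ i)
ren ρ (abst W T) = abst (ren ρ W) (ren (⇑ʳ ρ) T)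
ren ρ (abbr V T) = abbr (ren ρ V) (ren (⇑ʳ ρ) T)
ren ρ (appl V T) = appl (ren ρ V) (ren ρ T)
ren ρ (cast W T) = cast (ren ρ W) (ren ρ T)

⇑ˢ : (ℕ → Term) → ℕ → Term
⇑ˢ σ zero    = # zero
⇑ˢ σ (suc i) = ren suc (σ i)

sub : (ℕ → Term) → Term → Term
sub σ (⋆ h)      = ⋆ h
sub σ (# i)      = σ i
sub σ (abst W T) = abst (sub σ W) (sub (⇑ˢ σ) T)
sub σ (abbr V T) = abbr (sub σ V) (sub (⇑ˢ σ) T)
sub σ (appl V T) = appl (sub σ V) (sub σ T)
sub σ (cast W T) = cast (sub σ W) (sub σ T)

infixr 5 _∷ˢ_
_∷ˢ_ : Term → (ℕ → Term) → ℕ → Term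
(V ∷ˢ σ) zero    = V
(V ∷ˢ σ) (suc i) = σ i

_[_]₀ : Term → Term → Term
T [ V ]₀ = sub (V ∷ˢ #) T

⇑ʳ-cong : ∀ {ρ ρ'} → ρ ≗ ρ' → ⇑ʳ ρ ≗ ⇑ʳ ρ'
⇑ʳ-cong ρ≗ρ' zero    = refl
⇑ʳ-cong ρ≗ρ' (suc i) = cong suc (ρ≗ρ' i)

ren-cong : ∀ {ρ ρ'} → ρ ≗ ρ' → ren ρ ≗ ren ρ'
ren-cong ρ≗ρ' (⋆ h)      = refl
ren-cong ρ≗ρ' (# i)      = cong # (ρ≗ρ' i)
ren-cong ρ≗ρ' (abst W T) = cong₂ abst (ren-cong ρ≗ρ' W) (ren-cong (⇑ʳ-cong ρ≗ρ') T)
ren-cong ρ≗ρ' (abbr V T) = cong₂ abbr (ren-cong ρ≗ρ' V) (ren-cong (⇑ʳ-cong ρ≗ρ') T)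
ren-cong ρ≗ρ' (appl V T) = cong₂ appl (ren-cong ρ≗ρ' V) (ren-cong ρ≗ρ' T)
ren-cong ρ≗ρ' (cast W T) = cong₂ cast (ren-cong ρ≗ρ' W) (ren-cong ρ≗ρ' T)

⇑ˢ-cong : ∀ {σ σ'} → σ ≗ σ' → ⇑ˢ σ ≗ ⇑ˢ σ'
⇑ˢ-cong σ≗σ' zero    = refl
⇑ˢ-cong σ≗σ' (suc i) = cong (ren suc) (σ≗σ' i)

sub-cong : ∀ {σ σ'} → σ ≗ σ' → sub σ ≗ sub σ'
sub-cong σ≗σ' (⋆ h)      = refl
sub-cong σ≗σ' (# i)      = σ≗σ' i
sub-cong σ≗σ' (abst W T) = cong₂ abst (sub-cong σ≗σ' W) (sub-cong (⇑ˢ-cong σ≗σ') T)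
sub-cong σ≗σ' (abbr V T) = cong₂ abbr (sub-cong σ≗σ' V) (sub-cong (⇑ˢ-cong σ≗σ') T)
sub-cong σ≗σ' (appl V T) = cong₂ appl (sub-cong σ≗σ' V) (sub-cong σ≗σ' T)
sub-cong σ≗σ' (cast W T) = cong₂ cast (sub-cong σ≗σ' W) (sub-cong σ≗σ' T)

⇑ʳ-∘ : ∀ ρ ρ' → ⇑ʳ ρ ∘ ⇑ʳ ρ' ≗ ⇑ʳ (ρ ∘ ρ')
⇑ʳ-∘ ρ ρ' zero    = refl
⇑ʳ-∘ ρ ρ' (suc i) = refl

ren-ren : ∀ ρ ρ' T → ren ρ (ren ρ' T) ≡ ren (ρ ∘ ρ') T
ren-ren ρ ρ' (⋆ h)      = refl
ren-ren ρ ρ' (# i)      = refl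
ren-ren ρ ρ' (abst W T) = cong₂ abst (ren-ren ρ ρ' W)
  (trans (ren-ren (⇑ʳ ρ) (⇑ʳ ρ') T) (ren-cong (⇑ʳ-∘ ρ ρ') T))
ren-ren ρ ρ' (abbr V T) = cong₂ abbr (ren-ren ρ ρ' V)
  (trans (ren-ren (⇑ʳ ρ) (⇑ʳ ρ') T) (ren-cong (⇑ʳ-∘ ρ ρ') T))
ren-ren ρ ρ' (appl V T) = cong₂ appl (ren-ren ρ ρ' V) (ren-ren ρ ρ' T)
ren-ren ρ ρ' (cast W T) = cong₂ cast (ren-ren ρ ρ' W) (ren-ren ρ ρ' T)

ren-⇑ʳ-suc : ∀ ρ T → ren (⇑ʳ ρ) (ren suc T) ≡ ren suc (ren ρ T)
ren-⇑ʳ-suc ρ T = trans (ren-ren (⇑ʳ ρ) suc T) (sym (ren-ren suc ρ T))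

⇑ˢ-⇑ʳ : ∀ σ ρ → ⇑ˢ σ ∘ ⇑ʳ ρ ≗ ⇑ˢ (σ ∘ ρ)
⇑ˢ-⇑ʳ σ ρ zero    = refl
⇑ˢ-⇑ʳ σ ρ (suc i) = refl

sub-ren : ∀ σ ρ T → sub σ (ren ρ T) ≡ sub (σ ∘ ρ) T
sub-ren σ ρ (⋆ h)      = refl
sub-ren σ ρ (# i)      = refl
sub-ren σ ρ (abst W T) = cong₂ abst (sub-ren σ ρ W)
  (trans (sub-ren (⇑ˢ σ) (⇑ʳ ρ) T) (sub-cong (⇑ˢ-⇑ʳ σ ρ) T))
sub-ren σ ρ (abbr V T) = cong₂ abbr (sub-ren σ ρ V)
  (trans (sub-ren (⇑ˢ σ) (⇑ʳ ρ) T) (sub-cong (⇑ˢ-⇑ʳ σ ρ) T))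
sub-ren σ ρ (appl V T) = cong₂ appl (sub-ren σ ρ V) (sub-ren σ ρ T)
sub-ren σ ρ (cast W T) = cong₂ cast (sub-ren σ ρ W) (sub-ren σ ρ T)

ren-⇑ˢ : ∀ ρ σ → ren (⇑ʳ ρ) ∘ ⇑ˢ σ ≗ ⇑ˢ (ren ρ ∘ σ)
ren-⇑ˢ ρ σ zero    = refl
ren-⇑ˢ ρ σ (suc i) = ren-⇑ʳ-suc ρ (σ i)

ren-sub : ∀ ρ σ T → ren ρ (sub σ T) ≡ sub (ren ρ ∘ σ) T
ren-sub ρ σ (⋆ h)      = refl
ren-sub ρ σ (# i)      = refl
ren-sub ρ σ (abst W T) = cong₂ abst (ren-sub ρ σ W)
  (trans (ren-sub (⇑ʳ ρ) (⇑ˢ σ) T) (sub-cong (ren-⇑ˢ ρ σ) T))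
ren-sub ρ σ (abbr V T) = cong₂ abbr (ren-sub ρ σ V)
  (trans (ren-sub (⇑ʳ ρ) (⇑ˢ σ) T) (sub-cong (ren-⇑ˢ ρ σ) T))
ren-sub ρ σ (appl V T) = cong₂ appl (ren-sub ρ σ V) (ren-sub ρ σ T)
ren-sub ρ σ (cast W T) = cong₂ cast (ren-sub ρ σ W) (ren-sub ρ σ T)

sub-⇑ˢ-suc : ∀ σ T → sub (⇑ˢ σ) (ren suc T) ≡ ren suc (sub σ T)
sub-⇑ˢ-suc σ T = trans (sub-ren (⇑ˢ σ) suc T) (sym (ren-sub suc σ T))

sub-⇑ˢ : ∀ σ σ' → sub (⇑ˢ σ) ∘ ⇑ˢ σ' ≗ ⇑ˢ (sub σ ∘ σ')
sub-⇑ˢ σ σ' zero    = refl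
sub-⇑ˢ σ σ' (suc i) = sub-⇑ˢ-suc σ (σ' i)

sub-sub : ∀ σ σ' T → sub σ (sub σ' T) ≡ sub (sub σ ∘ σ') T
sub-sub σ σ' (⋆ h)      = refl
sub-sub σ σ' (# i)      = refl
sub-sub σ σ' (abst W T) = cong₂ abst (sub-sub σ σ' W)
  (trans (sub-sub (⇑ˢ σ) (⇑ˢ σ') T) (sub-cong (sub-⇑ˢ σ σ') T))
sub-sub σ σ' (abbr V T) = cong₂ abbr (sub-sub σ σ' V)
  (trans (sub-sub (⇑ˢ σ) (⇑ˢ σ') T) (sub-cong (sub-⇑ˢ σ σ') T))
sub-sub σ σ' (appl V T) = cong₂ appl (sub-sub σ σ' V) (sub-sub σ σ' T)
sub-sub σ σ' (cast W T) = cong₂ cast (sub-sub σ σ' W) (sub-sub σ σ' T)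

⇑ˢ-id : ⇑ˢ # ≗ #
⇑ˢ-id zero    = refl
⇑ˢ-id (suc i) = refl

sub-id : ∀ T → sub # T ≡ T
sub-id (⋆ h)      = refl
sub-id (# i)      = refl
sub-id (abst W T) = cong₂ abst (sub-id W) (trans (sub-cong ⇑ˢ-id T) (sub-id T))
sub-id (abbr V T) = cong₂ abbr (sub-id V) (trans (sub-cong ⇑ˢ-id T) (sub-id T))
sub-id (appl V T) = cong₂ appl (sub-id V) (sub-id T)
sub-id (cast W T) = cong₂ cast (sub-id W) (sub-id T)

[]₀-weaken : ∀ V T → (ren suc T) [ V ]₀ ≡ T
[]₀-weaken V T = trans (sub-ren (V ∷ˢ #) suc T) (sub-id T)

sub-[]₀ : ∀ σ V T → sub σ (T [ V ]₀) ≡ (sub (⇑ˢ σ) T) [ sub σ V ]₀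
sub-[]₀ σ V T = trans (sub-sub σ (V ∷ˢ #) T)
  (trans (sub-cong pointwise T) (sym (sub-sub (sub σ V ∷ˢ #) (⇑ˢ σ) T)))
  where
  pointwise : sub σ ∘ (V ∷ˢ #) ≗ sub (sub σ V ∷ˢ #) ∘ ⇑ˢ σ
  pointwise zero    = refl
  pointwise (suc i) = sym ([]₀-weaken (sub σ V) (σ i))

ren-[]₀ : ∀ ρ V T → ren ρ (T [ V ]₀) ≡ (ren (⇑ʳ ρ) T) [ ren ρ V ]₀
ren-[]₀ ρ V T = trans (ren-sub ρ (V ∷ˢ #) T)
  (trans (sub-cong pointwise T) (sym (sub-ren (ren ρ V ∷ˢ #) (⇑ʳ ρ) T)))
  where
  pointwise : ren ρ ∘ (V ∷ˢ #) ≗ (ren ρ V ∷ˢ #) ∘ ⇑ʳ ρ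
  pointwise zero    = refl
  pointwise (suc i) = refl

shiftʳ : ℕ → ℕ → ℕ → ℕ
shiftʳ d c i = if i <ᵇ c then i else i + d

shiftʳ-suc : ∀ d c → shiftʳ d (suc c) ≗ ⇑ʳ (shiftʳ d c)
shiftʳ-suc d c zero = refl
shiftʳ-suc d c (suc i) with i <ᵇ c
... | true  = refl
... | false = refl

shift-ren : ∀ d c T → shift d c T ≡ ren (shiftʳ d c) T
shift-ren d c (⋆ h) = refl
shift-ren d c (# i) with i <ᵇ c
... | true  = refl
... | false = refl
shift-ren d c (abst W T) = cong₂ abst (shift-ren d c W)
  (trans (shift-ren d (suc c) T) (ren-cong (shiftʳ-suc d c) T))
shift-ren d c (abbr V T) = cong₂ abbr (shift-ren d c V)
  (trans (shift-ren d (suc c) T) (ren-cong (shiftʳ-suc d c) T))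
shift-ren d c (appl V T) = cong₂ appl (shift-ren d c V) (shift-ren d c T)
shift-ren d c (cast W T) = cong₂ cast (shift-ren d c W) (shift-ren d c T)

shift₀-ren : ∀ d T → shift d 0 T ≡ ren (_+ d) T
shift₀-ren d = shift-ren d 0

shift₁-ren : ∀ T → shift 1 0 T ≡ ren suc T
shift₁-ren T = trans (shift₀-ren 1 T) (ren-cong (λ i → +-comm i 1) T)

ren-suc-shift₀ : ∀ d T → ren suc (shift d 0 T) ≡ shift (suc d) 0 T
ren-suc-shift₀ d T = begin
  ren suc (shift d 0 T)        ≡⟨ cong (ren suc) (shift₀-ren d T) ⟩
  ren suc (ren (_+ d) T)       ≡⟨ ren-ren suc (_+ d) T ⟩
  ren (suc ∘ (_+ d)) T         ≡⟨ ren-cong (λ i → sym (+-suc i d)) T ⟩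
  ren (_+ suc d) T             ≡⟨ shift₀-ren (suc d) T ⟨
  shift (suc d) 0 T            ∎
  where open ≡-Reasoning

shift₁-[]₀ : ∀ V T → (shift 1 0 T) [ V ]₀ ≡ T
shift₁-[]₀ V T = trans (cong (_[ V ]₀) (shift₁-ren T)) ([]₀-weaken V T)

-- Parallel reduction

-- The definitions in scope, innermost last; D ‼ i is the definition of the
-- variable i, if it has one, weakened to the current scope.
infixl 5 _▸_
data Defns : Set where
  []  : Defns
  _▸_ : Defns → Maybe Term → Defns

_‼_ : Defns → ℕ → Maybe Term
[]      ‼ i     = nothing
(D ▸ m) ‼ zero  = map (ren suc) m
(D ▸ m) ‼ suc i = map (ren suc) (D ‼ i)

⇑ᵈ : Defns → Defns
⇑ᵈ D = D ▸ nothing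

map-just⁻¹ : ∀ {f : Term → Term} {m t} → map f m ≡ just t → ∃ λ t₀ → m ≡ just t₀ × f t₀ ≡ t
map-just⁻¹ {m = just t₀} refl = t₀ , refl , refl

infix 4 _⊢_⇛_ _⊢_⇛*_ _⊢_≋_

-- Unlike δ, which replaces chosen occurrences, ⇛-let substitutes the
-- abbreviation everywhere: this is what gives ⇛ the triangle property.
data _⊢_⇛_ : Defns → Term → Term → Set where
  ⇛-sort   : ∀ {D h} → D ⊢ ⋆ h ⇛ ⋆ h
  ⇛-var    : ∀ {D i} → D ⊢ # i ⇛ # i
  ⇛-unfold : ∀ {D i t} → D ‼ i ≡ just t → D ⊢ # i ⇛ t
  ⇛-abst   : ∀ {D W W' T T'} → D ⊢ W ⇛ W' → ⇑ᵈ D ⊢ T ⇛ T' → D ⊢ abst W T ⇛ abst W' T'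
  ⇛-abbr   : ∀ {D V V' T T'} → D ⊢ V ⇛ V' → ⇑ᵈ D ⊢ T ⇛ T' → D ⊢ abbr V T ⇛ abbr V' T'
  ⇛-let    : ∀ {D V V' T T'} → D ⊢ V ⇛ V' → ⇑ᵈ D ⊢ T ⇛ T' → D ⊢ abbr V T ⇛ T' [ V' ]₀
  ⇛-appl   : ∀ {D V V' T T'} → D ⊢ V ⇛ V' → D ⊢ T ⇛ T' → D ⊢ appl V T ⇛ appl V' T'
  ⇛-β      : ∀ {D V V' W T T'} → D ⊢ V ⇛ V' → ⇑ᵈ D ⊢ T ⇛ T' →
             D ⊢ appl V (abst W T) ⇛ T' [ V' ]₀
  ⇛-cast   : ∀ {D W W' T T'} → D ⊢ W ⇛ W' → D ⊢ T ⇛ T' → D ⊢ cast W T ⇛ cast W' T'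
  ⇛-τ      : ∀ {D W T T'} → D ⊢ T ⇛ T' → D ⊢ cast W T ⇛ T'

_⊢_⇛*_ : Defns → Term → Term → Set
D ⊢ T ⇛* T' = Star (D ⊢_⇛_) T T'

_⊢_≋_ : Defns → Term → Term → Set
D ⊢ T ≋ T' = EqClosure (D ⊢_⇛_) T T'

⇛-≡ : ∀ {D T T' T''} → D ⊢ T ⇛ T' → T' ≡ T'' → D ⊢ T ⇛ T''
⇛-≡ p refl = p

⇛-refl : ∀ {D} T → D ⊢ T ⇛ T
⇛-refl (⋆ h)      = ⇛-sort
⇛-refl (# i)      = ⇛-var
⇛-refl (abst W T) = ⇛-abst (⇛-refl W) (⇛-refl T)
⇛-refl (abbr V T) = ⇛-abbr (⇛-refl V) (⇛-refl T)
⇛-refl (appl V T) = ⇛-appl (⇛-refl V) (⇛-refl T)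
⇛-refl (cast W T) = ⇛-cast (⇛-refl W) (⇛-refl T)

record Renames (ρ : ℕ → ℕ) (D D' : Defns) : Set where
  field renames : ∀ {i t} → D ‼ i ≡ just t → D' ‼ ρ i ≡ just (ren ρ t)
open Renames

suc-renames : ∀ {D} → Renames suc D (⇑ᵈ D)
renames suc-renames = map-just

⇑-renames : ∀ {ρ D D'} → Renames ρ D D' → Renames (⇑ʳ ρ) (⇑ᵈ D) (⇑ᵈ D')
renames (⇑-renames {ρ} ρ-ren) {suc i} D▸i≡t with map-just⁻¹ {f = ren suc} D▸i≡t
... | t₀ , Di≡t₀ , refl = trans (map-just (renames ρ-ren Di≡t₀)) (cong just (sym (ren-⇑ʳ-suc ρ t₀)))

⇛-ren : ∀ {ρ D D' T T'} → Renames ρ D D' → D ⊢ T ⇛ T' → D' ⊢ ren ρ T ⇛ ren ρ T'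
⇛-ren ρ-ren ⇛-sort              = ⇛-sort
⇛-ren ρ-ren ⇛-var               = ⇛-var
⇛-ren ρ-ren (⇛-unfold Di≡t)     = ⇛-unfold (renames ρ-ren Di≡t)
⇛-ren ρ-ren (⇛-abst p q)        = ⇛-abst (⇛-ren ρ-ren p) (⇛-ren (⇑-renames ρ-ren) q)
⇛-ren ρ-ren (⇛-abbr p q)        = ⇛-abbr (⇛-ren ρ-ren p) (⇛-ren (⇑-renames ρ-ren) q)
⇛-ren {ρ} ρ-ren (⇛-let {V' = V'} {T' = T'} p q) =
  ⇛-≡ (⇛-let (⇛-ren ρ-ren p) (⇛-ren (⇑-renames ρ-ren) q)) (sym (ren-[]₀ ρ V' T'))
⇛-ren ρ-ren (⇛-appl p q)        = ⇛-appl (⇛-ren ρ-ren p) (⇛-ren ρ-ren q)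
⇛-ren {ρ} ρ-ren (⇛-β {V' = V'} {T' = T'} p q) =
  ⇛-≡ (⇛-β (⇛-ren ρ-ren p) (⇛-ren (⇑-renames ρ-ren) q)) (sym (ren-[]₀ ρ V' T'))
⇛-ren ρ-ren (⇛-cast p q)        = ⇛-cast (⇛-ren ρ-ren p) (⇛-ren ρ-ren q)
⇛-ren ρ-ren (⇛-τ p)             = ⇛-τ (⇛-ren ρ-ren p)

record Substitutes (D D' : Defns) (σ σ' : ℕ → Term) : Set where
  field
    pointwise : ∀ i → D' ⊢ σ i ⇛ σ' i
    unfolds : ∀ {i t} → D ‼ i ≡ just t → D' ⊢ σ i ⇛ sub σ' t
open Substitutes

⇑-substitutes : ∀ {D D' σ σ'} → Substitutes D D' σ σ' → Substitutes (⇑ᵈ D) (⇑ᵈ D') (⇑ˢ σ) (⇑ˢ σ')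
pointwise (⇑-substitutes σ-sub) zero    = ⇛-var
pointwise (⇑-substitutes σ-sub) (suc i) = ⇛-ren suc-renames (pointwise σ-sub i)
unfolds (⇑-substitutes {σ' = σ'} σ-sub) {suc i} D▸i≡t with map-just⁻¹ {f = ren suc} D▸i≡t
... | t₀ , Di≡t₀ , refl =
  ⇛-≡ (⇛-ren suc-renames (unfolds σ-sub Di≡t₀)) (sym (sub-⇑ˢ-suc σ' t₀))

⇛-sub : ∀ {D D' σ σ' T T'} → Substitutes D D' σ σ' → D ⊢ T ⇛ T' → D' ⊢ sub σ T ⇛ sub σ' T'
⇛-sub σ-sub ⇛-sort          = ⇛-sort
⇛-sub σ-sub ⇛-var           = pointwise σ-sub _
⇛-sub σ-sub (⇛-unfold Di≡t) = unfolds σ-sub Di≡t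
⇛-sub σ-sub (⇛-abst p q)    = ⇛-abst (⇛-sub σ-sub p) (⇛-sub (⇑-substitutes σ-sub) q)
⇛-sub σ-sub (⇛-abbr p q)    = ⇛-abbr (⇛-sub σ-sub p) (⇛-sub (⇑-substitutes σ-sub) q)
⇛-sub {σ' = σ'} σ-sub (⇛-let {V' = V'} {T' = T'} p q) =
  ⇛-≡ (⇛-let (⇛-sub σ-sub p) (⇛-sub (⇑-substitutes σ-sub) q)) (sym (sub-[]₀ σ' V' T'))
⇛-sub σ-sub (⇛-appl p q)    = ⇛-appl (⇛-sub σ-sub p) (⇛-sub σ-sub q)
⇛-sub {σ' = σ'} σ-sub (⇛-β {V' = V'} {T' = T'} p q) =
  ⇛-≡ (⇛-β (⇛-sub σ-sub p) (⇛-sub (⇑-substitutes σ-sub) q)) (sym (sub-[]₀ σ' V' T'))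
⇛-sub σ-sub (⇛-cast p q)    = ⇛-cast (⇛-sub σ-sub p) (⇛-sub σ-sub q)
⇛-sub σ-sub (⇛-τ p)         = ⇛-τ (⇛-sub σ-sub p)

[]₀-substitutes : ∀ {D V V'} → D ⊢ V ⇛ V' → Substitutes (⇑ᵈ D) D (V ∷ˢ #) (V' ∷ˢ #)
pointwise ([]₀-substitutes V⇛V') zero    = V⇛V'
pointwise ([]₀-substitutes V⇛V') (suc i) = ⇛-var
unfolds ([]₀-substitutes {V' = V'} V⇛V') {suc i} D▸i≡t with map-just⁻¹ {f = ren suc} D▸i≡t
... | t₀ , Di≡t₀ , refl = ⇛-≡ (⇛-unfold Di≡t₀) (sym ([]₀-weaken V' t₀))

⇛-[]₀ : ∀ {D V V' T T'} → D ⊢ V ⇛ V' → ⇑ᵈ D ⊢ T ⇛ T' → D ⊢ T [ V ]₀ ⇛ T' [ V' ]₀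
⇛-[]₀ V⇛V' = ⇛-sub ([]₀-substitutes V⇛V')

-- Confluence

develop : Defns → Term → Term
develop D (⋆ h)               = ⋆ h
develop D (# i)               = fromMaybe (# i) (D ‼ i)
develop D (abst W T)          = abst (develop D W) (develop (⇑ᵈ D) T)
develop D (abbr V T)          = (develop (⇑ᵈ D) T) [ develop D V ]₀
develop D (appl V (abst W T)) = (develop (⇑ᵈ D) T) [ develop D V ]₀
develop D (appl V T)          = appl (develop D V) (develop D T)
develop D (cast W T)          = develop D T

⇛-develop-var : ∀ D i → D ⊢ # i ⇛ develop D (# i)
⇛-develop-var D i with D ‼ i in Di≡t
... | nothing = ⇛-var
... | just t  = ⇛-unfold Di≡t

triangle : ∀ {D T T'} → D ⊢ T ⇛ T' → D ⊢ T' ⇛ develop D T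
triangle ⇛-sort                    = ⇛-sort
triangle {D} (⇛-var {i = i})       = ⇛-develop-var D i
triangle (⇛-unfold {t = t} Di≡t) rewrite Di≡t = ⇛-refl t
triangle (⇛-abst p q)              = ⇛-abst (triangle p) (triangle q)
triangle (⇛-abbr p q)              = ⇛-let (triangle p) (triangle q)
triangle (⇛-let p q)               = ⇛-[]₀ (triangle p) (triangle q)
triangle (⇛-appl p (⇛-abst q r))   = ⇛-β (triangle p) (triangle r)
-- The other heads are listed one by one so that develop D (appl V T) computes.
triangle (⇛-appl p q@⇛-sort)       = ⇛-appl (triangle p) (triangle q)
triangle (⇛-appl p q@⇛-var)        = ⇛-appl (triangle p) (triangle q)
triangle (⇛-appl p q@(⇛-unfold _)) = ⇛-appl (triangle p) (triangle q)
triangle (⇛-appl p q@(⇛-abbr _ _)) = ⇛-appl (triangle p) (triangle q)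
triangle (⇛-appl p q@(⇛-let _ _))  = ⇛-appl (triangle p) (triangle q)
triangle (⇛-appl p q@(⇛-appl _ _)) = ⇛-appl (triangle p) (triangle q)
triangle (⇛-appl p q@(⇛-β _ _))    = ⇛-appl (triangle p) (triangle q)
triangle (⇛-appl p q@(⇛-cast _ _)) = ⇛-appl (triangle p) (triangle q)
triangle (⇛-appl p q@(⇛-τ _))      = ⇛-appl (triangle p) (triangle q)
triangle (⇛-β p q)                 = ⇛-[]₀ (triangle p) (triangle q)
triangle (⇛-cast p q)              = ⇛-τ (triangle q)
triangle (⇛-τ p)                   = triangle p

strip : ∀ {D T T₁ T₂} → D ⊢ T ⇛ T₁ → D ⊢ T ⇛* T₂ → ∃ λ S → D ⊢ T₁ ⇛* S × D ⊢ T₂ ⇛ S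
strip {T₁ = T₁} p ε = T₁ , ε , p
strip p (q ◅ qs) with strip (triangle q) qs
... | S , devT⇛*S , T₂⇛S = S , triangle p ◅ devT⇛*S , T₂⇛S

≋-joinable : ∀ {D T₁ T₂} → D ⊢ T₁ ≋ T₂ → ∃ λ S → D ⊢ T₁ ⇛* S × D ⊢ T₂ ⇛* S
≋-joinable {T₁ = T₁} ε = T₁ , ε , ε
≋-joinable (fwd p ◅ c) with ≋-joinable c
... | S , T⇛*S , T₂⇛*S = S , p ◅ T⇛*S , T₂⇛*S
≋-joinable (bwd p ◅ c) with ≋-joinable c
... | S , T⇛*S , T₂⇛*S with strip p T⇛*S
...   | S' , T₁⇛*S' , S⇛S' = S' , T₁⇛*S' , T₂⇛*S ◅◅ (S⇛S' ◅ ε)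

-- Conversion in λδ

≋-cong₂ : ∀ {D D₁ D₂ A A' T T'} (f : Term → Term → Term) →
          (∀ {A A' T T'} → D₁ ⊢ A ⇛ A' → D₂ ⊢ T ⇛ T' → D ⊢ f A T ⇛ f A' T') →
          D₁ ⊢ A ≋ A' → D₂ ⊢ T ≋ T' → D ⊢ f A T ≋ f A' T'
≋-cong₂ {A' = A'} {T = T} f f-⇛ A≋A' T≋T' =
  gmap (λ X → f X T) (λ p → f-⇛ p (⇛-refl T)) A≋A' ◅◅ gmap (f A') (f-⇛ (⇛-refl A')) T≋T'

≋-join : ∀ {D T₁ T₂ S} → D ⊢ T₁ ⇛ S → D ⊢ T₂ ⇛ S → D ⊢ T₁ ≋ T₂
≋-join p q = fwd p ◅ bwd q ◅ ε

⇛-let-refl : ∀ {D} V T → D ⊢ abbr V T ⇛ T [ V ]₀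
⇛-let-refl V T = ⇛-let (⇛-refl V) (⇛-refl T)

⇑ˢ-fixes : ∀ {σ i} W → sub σ W ≡ σ i → sub (⇑ˢ σ) (shift 1 0 W) ≡ ⇑ˢ σ (suc i)
⇑ˢ-fixes {σ} {i} W σW≡σi = begin
  sub (⇑ˢ σ) (shift 1 0 W) ≡⟨ cong (sub (⇑ˢ σ)) (shift₁-ren W) ⟩
  sub (⇑ˢ σ) (ren suc W)   ≡⟨ sub-⇑ˢ-suc σ W ⟩
  ren suc (sub σ W)        ≡⟨ cong (ren suc) σW≡σi ⟩
  ren suc (σ i)            ∎
  where open ≡-Reasoning

PSub-sub : ∀ {i W T T' n} σ → PSub i W T T' n → sub σ W ≡ σ i → sub σ T' ≡ sub σ T
PSub-sub σ sortS σW≡σi = refl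
PSub-sub σ keep  σW≡σi = refl
PSub-sub σ repl  σW≡σi = σW≡σi
PSub-sub {W = W} σ (abstS a b) σW≡σi =
  cong₂ abst (PSub-sub σ a σW≡σi) (PSub-sub (⇑ˢ σ) b (⇑ˢ-fixes W σW≡σi))
PSub-sub {W = W} σ (abbrS a b) σW≡σi =
  cong₂ abbr (PSub-sub σ a σW≡σi) (PSub-sub (⇑ˢ σ) b (⇑ˢ-fixes W σW≡σi))
PSub-sub σ (applS a b) σW≡σi = cong₂ appl (PSub-sub σ a σW≡σi) (PSub-sub σ b σW≡σi)
PSub-sub σ (castS a b) σW≡σi = cong₂ cast (PSub-sub σ a σW≡σi) (PSub-sub σ b σW≡σi)

⇑ᵈ-‼-suc : ∀ D i {W} → D ‼ i ≡ just W → ⇑ᵈ D ‼ suc i ≡ just (shift 1 0 W)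
⇑ᵈ-‼-suc D i {W} Di≡W = trans (map-just Di≡W) (cong just (sym (shift₁-ren W)))

PSub-⇛ : ∀ {D i W T T' n} → PSub i W T T' n → D ‼ i ≡ just W → D ⊢ T ⇛ T'
PSub-⇛ sortS                   Di≡W = ⇛-sort
PSub-⇛ keep                    Di≡W = ⇛-var
PSub-⇛ repl                    Di≡W = ⇛-unfold Di≡W
PSub-⇛ {D} {i} (abstS a b) Di≡W = ⇛-abst (PSub-⇛ a Di≡W) (PSub-⇛ b (⇑ᵈ-‼-suc D i Di≡W))
PSub-⇛ {D} {i} (abbrS a b) Di≡W = ⇛-abbr (PSub-⇛ a Di≡W) (PSub-⇛ b (⇑ᵈ-‼-suc D i Di≡W))
PSub-⇛ (applS a b)             Di≡W = ⇛-appl (PSub-⇛ a Di≡W) (PSub-⇛ b Di≡W)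
PSub-⇛ (castS a b)             Di≡W = ⇛-cast (PSub-⇛ a Di≡W) (PSub-⇛ b Di≡W)

⇒₀-≋ : ∀ D {T₁ T₂} → T₁ ⇒₀ T₂ → D ⊢ T₁ ≋ T₂
⇒₀-≋ D refl₀       = ε
⇒₀-≋ D (abstC a t) = ≋-cong₂ abst ⇛-abst (⇒₀-≋ D a) (⇒₀-≋ (⇑ᵈ D) t)
⇒₀-≋ D (abbrC a t) = ≋-cong₂ abbr ⇛-abbr (⇒₀-≋ D a) (⇒₀-≋ (⇑ᵈ D) t)
⇒₀-≋ D (applC a t) = ≋-cong₂ appl ⇛-appl (⇒₀-≋ D a) (⇒₀-≋ D t)
⇒₀-≋ D (castC a t) = ≋-cong₂ cast ⇛-cast (⇒₀-≋ D a) (⇒₀-≋ D t)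
⇒₀-≋ D (β {V₂ = V₂} {W} {T₂ = T₂} v t) =
  ≋-cong₂ appl ⇛-appl (⇒₀-≋ D v) (≋-cong₂ abst ⇛-abst (ε {x = W}) (⇒₀-≋ (⇑ᵈ D) t))
  ◅◅ ≋-join (⇛-β (⇛-refl V₂) (⇛-refl T₂)) (⇛-let-refl V₂ T₂)
⇒₀-≋ D (δ {V₂ = V₂} {T₂ = T₂} {T} v t (_ , _ , _ , T₂↦T)) =
  ≋-cong₂ abbr ⇛-abbr (⇒₀-≋ D v) (⇒₀-≋ (⇑ᵈ D) t)
  ◅◅ ≋-join (⇛-let-refl V₂ T₂)
            (⇛-≡ (⇛-let-refl V₂ T) (PSub-sub (V₂ ∷ˢ #) T₂↦T (shift₁-[]₀ V₂ V₂)))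
⇒₀-≋ D (ζ {V} {T₁} t) =
  fwd (⇛-≡ (⇛-let-refl V (shift 1 0 T₁)) (shift₁-[]₀ V T₁)) ◅ ⇒₀-≋ D t
⇒₀-≋ D (τ t) = fwd (⇛-τ (⇛-refl _)) ◅ ⇒₀-≋ D t
⇒₀-≋ D (υ {V₃ = V₃} {V₄ = V₄} {T₂ = T₂} v₃ v₄ t) =
  ≋-cong₂ appl ⇛-appl (⇒₀-≋ D v₃) (≋-cong₂ abbr ⇛-abbr (⇒₀-≋ D v₄) (⇒₀-≋ (⇑ᵈ D) t))
  ◅◅ ≋-join (⇛-appl (⇛-refl V₃) (⇛-let-refl V₄ T₂))
            (⇛-≡ (⇛-let-refl V₄ (appl (shift 1 0 V₃) T₂))
                 (cong (λ X → appl X (T₂ [ V₄ ]₀)) (shift₁-[]₀ V₄ V₃)))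

envDefns : Env → Defns
envDefns (⋆E h)        = []
envDefns (E ∙ λI W)    = envDefns E ▸ nothing
envDefns (E ∙ δI V)    = envDefns E ▸ just V
envDefns (E ∙ applI _) = envDefns E
envDefns (E ∙ castI _) = envDefns E

envDefns-‼ : ∀ C₁ V C₂ →
             envDefns (C₁ ·[ δI V ]· C₂) ‼ binders C₂ ≡ just (shift (suc (binders C₂)) 0 V)
envDefns-‼ C₁ V (⋆E h)        = cong just (sym (shift₁-ren V))
envDefns-‼ C₁ V (C ∙ λI _)    = trans (map-just (envDefns-‼ C₁ V C)) (cong just (ren-suc-shift₀ _ V))
envDefns-‼ C₁ V (C ∙ δI _)    = trans (map-just (envDefns-‼ C₁ V C)) (cong just (ren-suc-shift₀ _ V))
envDefns-‼ C₁ V (C ∙ applI _) = envDefns-‼ C₁ V C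
envDefns-‼ C₁ V (C ∙ castI _) = envDefns-‼ C₁ V C

⇒-≋ : ∀ {E T₁ T₂} → E ⊢ T₁ ⇒ T₂ → envDefns E ⊢ T₁ ≋ T₂
⇒-≋ (free r) = ⇒₀-≋ _ r
⇒-≋ (unfold {C₁} {V} {C₂} r (_ , _ , _ , T'↦T₂)) =
  ⇒₀-≋ _ r ◅◅ return (PSub-⇛ T'↦T₂ (envDefns-‼ C₁ V C₂))

⇔-≋ : ∀ {E T₁ T₂} → E ⊢ T₁ ⇔ T₂ → envDefns E ⊢ T₁ ≋ T₂
⇔-≋ (step s)          = ⇒-≋ s
⇔-≋ (symm c)          = symmetric _ (⇔-≋ c)
⇔-≋ (Defs.trans c c') = ⇔-≋ c ◅◅ ⇔-≋ c'

-- Simple kinds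

infixr 6 _⇾_
data Kind : Set where
  ι   : Kind
  _⇾_ : Kind → Kind → Kind

_≟ₖ_ : (a b : Kind) → Dec (a ≡ b)
ι       ≟ₖ ι         = yes refl
ι       ≟ₖ (_ ⇾ _)   = no λ ()
(_ ⇾ _) ≟ₖ ι         = no λ ()
(a ⇾ b) ≟ₖ (a' ⇾ b') with a ≟ₖ a' | b ≟ₖ b'
... | yes refl | yes refl = yes refl
... | no a≢a'  | _        = no λ { refl → a≢a' refl }
... | yes _    | no b≢b'  = no λ { refl → b≢b' refl }

a⇾b≢b : ∀ a b → a ⇾ b ≢ b
a⇾b≢b a ι       ()
a⇾b≢b a (c ⇾ d) e = a⇾b≢b c d (cong codomain e)
  where codomain : Kind → Kind
        codomain ι       = ι
        codomain (_ ⇾ b) = b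

KindCtx : Set
KindCtx = ℕ → Maybe Kind

extend : Maybe Kind → KindCtx → KindCtx
extend m Γ zero    = m
extend m Γ (suc i) = Γ i

arrowₖ : Maybe Kind → Maybe Kind → Maybe Kind
arrowₖ (just a) (just b) = just (a ⇾ b)
arrowₖ _        _        = nothing

applyₖ : Maybe Kind → Maybe Kind → Maybe Kind
applyₖ (just a) (just (a' ⇾ b)) with a ≟ₖ a'
... | yes _ = just b
... | no _  = nothing
applyₖ _        _               = nothing

infixr 4 _≫_
_≫_ : Maybe Kind → Maybe Kind → Maybe Kind
just _  ≫ m = m
nothing ≫ _ = nothing

-- A cast takes the kind of its subject, not of its type, because τ drops the type.
kindOf : KindCtx → Term → Maybe Kind
kindOf Γ (⋆ h)      = just ι
kindOf Γ (# i)      = Γ i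
kindOf Γ (abst W T) = arrowₖ (kindOf Γ W) (kindOf (extend (kindOf Γ W) Γ) T)
kindOf Γ (abbr V T) = kindOf Γ V ≫ kindOf (extend (kindOf Γ V) Γ) T
kindOf Γ (appl V T) = applyₖ (kindOf Γ V) (kindOf Γ T)
kindOf Γ (cast W T) = kindOf Γ W ≫ kindOf Γ T

arrowₖ⁻ : ∀ {m n k} → arrowₖ m n ≡ just k → ∃₂ λ a b → m ≡ just a × n ≡ just b × k ≡ a ⇾ b
arrowₖ⁻ {just a} {just b} refl = a , b , refl , refl , refl

applyₖ⁻ : ∀ {m n k} → applyₖ m n ≡ just k → ∃ λ a → m ≡ just a × n ≡ just (a ⇾ k)
applyₖ⁻ {just a} {just (a' ⇾ b)} e with a ≟ₖ a'
applyₖ⁻ {just a} {just (a ⇾ b)} refl | yes refl = a , refl , refl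

≫⁻ : ∀ {m n k} → (m ≫ n) ≡ just k → ∃ λ a → m ≡ just a × n ≡ just k
≫⁻ {just a} n≡k = a , refl , n≡k

arrowₖ⁺ : ∀ {m n a b} → m ≡ just a → n ≡ just b → arrowₖ m n ≡ just (a ⇾ b)
arrowₖ⁺ refl refl = refl

applyₖ⁺ : ∀ {m n a b} → m ≡ just a → n ≡ just (a ⇾ b) → applyₖ m n ≡ just b
applyₖ⁺ {a = a} refl refl with a ≟ₖ a
... | yes _   = refl
... | no a≢a = contradiction refl a≢a

≫⁺ : ∀ {m n a b} → m ≡ just a → n ≡ just b → (m ≫ n) ≡ just b
≫⁺ refl n≡b = n≡b

extend-ren : ∀ {Γ Γ' ρ m m'} → m' ≡ m → (∀ i → Γ' (ρ i) ≡ Γ i) →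
             ∀ i → extend m' Γ' (⇑ʳ ρ i) ≡ extend m Γ i
extend-ren m'≡m ρ-ok zero    = m'≡m
extend-ren m'≡m ρ-ok (suc i) = ρ-ok i

kindOf-ren : ∀ {Γ Γ'} ρ → (∀ i → Γ' (ρ i) ≡ Γ i) → ∀ T → kindOf Γ' (ren ρ T) ≡ kindOf Γ T
kindOf-ren ρ ρ-ok (⋆ h)      = refl
kindOf-ren ρ ρ-ok (# i)      = ρ-ok i
kindOf-ren ρ ρ-ok (abst W T) = cong₂ arrowₖ (kindOf-ren ρ ρ-ok W)
  (kindOf-ren (⇑ʳ ρ) (extend-ren (kindOf-ren ρ ρ-ok W) ρ-ok) T)
kindOf-ren ρ ρ-ok (abbr V T) = cong₂ _≫_ (kindOf-ren ρ ρ-ok V)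
  (kindOf-ren (⇑ʳ ρ) (extend-ren (kindOf-ren ρ ρ-ok V) ρ-ok) T)
kindOf-ren ρ ρ-ok (appl V T) = cong₂ applyₖ (kindOf-ren ρ ρ-ok V) (kindOf-ren ρ ρ-ok T)
kindOf-ren ρ ρ-ok (cast W T) = cong₂ _≫_ (kindOf-ren ρ ρ-ok W) (kindOf-ren ρ ρ-ok T)

kindOf-weaken : ∀ {Γ m} T → kindOf (extend m Γ) (ren suc T) ≡ kindOf Γ T
kindOf-weaken = kindOf-ren suc (λ _ → refl)

kindOf-shift₁ : ∀ {Γ m} T → kindOf (extend m Γ) (shift 1 0 T) ≡ kindOf Γ T
kindOf-shift₁ T = trans (cong (kindOf _) (shift₁-ren T)) (kindOf-weaken T)

extend-sub : ∀ {Γ Γ' σ m m'} → m' ≡ m → (∀ i → kindOf Γ' (σ i) ≡ Γ i) →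
             ∀ i → kindOf (extend m' Γ') (⇑ˢ σ i) ≡ extend m Γ i
extend-sub m'≡m σ-ok zero    = m'≡m
extend-sub {σ = σ} m'≡m σ-ok (suc i) = trans (kindOf-weaken (σ i)) (σ-ok i)

kindOf-sub : ∀ {Γ Γ'} σ → (∀ i → kindOf Γ' (σ i) ≡ Γ i) → ∀ T → kindOf Γ' (sub σ T) ≡ kindOf Γ T
kindOf-sub σ σ-ok (⋆ h)      = refl
kindOf-sub σ σ-ok (# i)      = σ-ok i
kindOf-sub σ σ-ok (abst W T) = cong₂ arrowₖ (kindOf-sub σ σ-ok W)
  (kindOf-sub (⇑ˢ σ) (extend-sub (kindOf-sub σ σ-ok W) σ-ok) T)
kindOf-sub σ σ-ok (abbr V T) = cong₂ _≫_ (kindOf-sub σ σ-ok V)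
  (kindOf-sub (⇑ˢ σ) (extend-sub (kindOf-sub σ σ-ok V) σ-ok) T)
kindOf-sub σ σ-ok (appl V T) = cong₂ applyₖ (kindOf-sub σ σ-ok V) (kindOf-sub σ σ-ok T)
kindOf-sub σ σ-ok (cast W T) = cong₂ _≫_ (kindOf-sub σ σ-ok W) (kindOf-sub σ σ-ok T)

kindOf-[]₀ : ∀ {Γ V m} T → kindOf Γ V ≡ m → kindOf Γ (T [ V ]₀) ≡ kindOf (extend m Γ) T
kindOf-[]₀ {Γ} {V} {m} T V∶m = kindOf-sub (V ∷ˢ #) V-ok T
  where V-ok : ∀ i → kindOf Γ ((V ∷ˢ #) i) ≡ extend m Γ i
        V-ok zero    = V∶m
        V-ok (suc i) = refl

kindOf-extend-≡ : ∀ {Γ m m'} T → m ≡ m' → kindOf (extend m Γ) T ≡ kindOf (extend m' Γ) T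
kindOf-extend-≡ {Γ} T = cong (λ m → kindOf (extend m Γ) T)

record DefnsKinded (Γ : KindCtx) (D : Defns) : Set where
  field kinded : ∀ {i t} → D ‼ i ≡ just t → kindOf Γ t ≡ Γ i
open DefnsKinded

▸-kinded : ∀ {Γ D m k} → DefnsKinded Γ D → (∀ {t} → m ≡ just t → kindOf Γ t ≡ k) →
           DefnsKinded (extend k Γ) (D ▸ m)
kinded (▸-kinded D-ok m-ok) {zero} e with map-just⁻¹ {f = ren suc} e
... | t , m≡t , refl = trans (kindOf-weaken t) (m-ok m≡t)
kinded (▸-kinded D-ok m-ok) {suc i} e with map-just⁻¹ {f = ren suc} e
... | t , Di≡t , refl = trans (kindOf-weaken t) (kinded D-ok Di≡t)

⇑ᵈ-kinded : ∀ {Γ D m} → DefnsKinded Γ D → DefnsKinded (extend m Γ) (⇑ᵈ D)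
⇑ᵈ-kinded D-ok = ▸-kinded D-ok λ ()

⇛-kind : ∀ {Γ D T T' k} → DefnsKinded Γ D → D ⊢ T ⇛ T' → kindOf Γ T ≡ just k → kindOf Γ T' ≡ just k
⇛-kind D-ok ⇛-sort          T∶k = T∶k
⇛-kind D-ok ⇛-var           T∶k = T∶k
⇛-kind D-ok (⇛-unfold Di≡t) T∶k = trans (kinded D-ok Di≡t) T∶k
⇛-kind D-ok (⇛-abst {T' = T'} p q) T∶k with arrowₖ⁻ T∶k
... | a , b , W∶a , T∶b , refl =
  arrowₖ⁺ W'∶a (trans (kindOf-extend-≡ T' (trans W'∶a (sym W∶a))) (⇛-kind (⇑ᵈ-kinded D-ok) q T∶b))
  where W'∶a = ⇛-kind D-ok p W∶a
⇛-kind D-ok (⇛-abbr {T' = T'} p q) T∶k with ≫⁻ T∶k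
... | a , V∶a , T∶k' =
  ≫⁺ V'∶a (trans (kindOf-extend-≡ T' (trans V'∶a (sym V∶a))) (⇛-kind (⇑ᵈ-kinded D-ok) q T∶k'))
  where V'∶a = ⇛-kind D-ok p V∶a
⇛-kind D-ok (⇛-let {T' = T'} p q) T∶k with ≫⁻ T∶k
... | a , V∶a , T∶k' =
  trans (kindOf-[]₀ T' (trans (⇛-kind D-ok p V∶a) (sym V∶a))) (⇛-kind (⇑ᵈ-kinded D-ok) q T∶k')
⇛-kind D-ok (⇛-appl p q) T∶k with applyₖ⁻ T∶k
... | a , V∶a , T∶a⇾k = applyₖ⁺ (⇛-kind D-ok p V∶a) (⇛-kind D-ok q T∶a⇾k)
⇛-kind D-ok (⇛-β {T' = T'} p q) T∶k with applyₖ⁻ T∶k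
... | a , V∶a , λ∶a⇾k with arrowₖ⁻ λ∶a⇾k
...   | _ , _ , W∶a , T∶k' , refl =
  trans (kindOf-[]₀ T' (trans (⇛-kind D-ok p V∶a) (sym W∶a))) (⇛-kind (⇑ᵈ-kinded D-ok) q T∶k')
⇛-kind D-ok (⇛-cast p q) T∶k with ≫⁻ T∶k
... | a , W∶a , T∶k' = ≫⁺ (⇛-kind D-ok p W∶a) (⇛-kind D-ok q T∶k')
⇛-kind D-ok (⇛-τ p) T∶k with ≫⁻ T∶k
... | a , W∶a , T∶k' = ⇛-kind D-ok p T∶k'

⇛*-kind : ∀ {Γ D T T' k} → DefnsKinded Γ D → D ⊢ T ⇛* T' → kindOf Γ T ≡ just k → kindOf Γ T' ≡ just k
⇛*-kind D-ok ε        T∶k = T∶k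
⇛*-kind D-ok (p ◅ ps) T∶k = ⇛*-kind D-ok ps (⇛-kind D-ok p T∶k)

≋-kind : ∀ {Γ D T₁ T₂ k₁ k₂} → DefnsKinded Γ D → D ⊢ T₁ ≋ T₂ →
         kindOf Γ T₁ ≡ just k₁ → kindOf Γ T₂ ≡ just k₂ → k₁ ≡ k₂
≋-kind D-ok T₁≋T₂ T₁∶k₁ T₂∶k₂ with ≋-joinable T₁≋T₂
... | S , T₁⇛*S , T₂⇛*S =
  just-injective (trans (sym (⇛*-kind D-ok T₁⇛*S T₁∶k₁)) (⇛*-kind D-ok T₂⇛*S T₂∶k₂))

kindCtx : Env → KindCtx
kindCtx (⋆E h)        = λ _ → nothing
kindCtx (E ∙ λI W)    = extend (kindOf (kindCtx E) W) (kindCtx E)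
kindCtx (E ∙ δI V)    = extend (kindOf (kindCtx E) V) (kindCtx E)
kindCtx (E ∙ applI _) = kindCtx E
kindCtx (E ∙ castI _) = kindCtx E

envDefns-kinded : ∀ E → DefnsKinded (kindCtx E) (envDefns E)
kinded (envDefns-kinded (⋆E h)) ()
envDefns-kinded (E ∙ λI W)    = ⇑ᵈ-kinded (envDefns-kinded E)
envDefns-kinded (E ∙ δI V)    = ▸-kinded (envDefns-kinded E) λ { refl → refl }
envDefns-kinded (E ∙ applI _) = envDefns-kinded E
envDefns-kinded (E ∙ castI _) = envDefns-kinded E

⇔-kind : ∀ E {U₁ U₂ k₁ k₂} → E ⊢ U₁ ⇔ U₂ →
         kindOf (kindCtx E) U₁ ≡ just k₁ → kindOf (kindCtx E) U₂ ≡ just k₂ → k₁ ≡ k₂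
⇔-kind E U₁⇔U₂ = ≋-kind (envDefns-kinded E) (⇔-≋ U₁⇔U₂)

kindCtx-setSort : ∀ h C → kindCtx (setSort h C) ≡ kindCtx C
kindCtx-setSort h (⋆E _)        = refl
kindCtx-setSort h (C ∙ λI W)    = cong (λ Γ → extend (kindOf Γ W) Γ) (kindCtx-setSort h C)
kindCtx-setSort h (C ∙ δI V)    = cong (λ Γ → extend (kindOf Γ V) Γ) (kindCtx-setSort h C)
kindCtx-setSort h (C ∙ applI _) = kindCtx-setSort h C
kindCtx-setSort h (C ∙ castI _) = kindCtx-setSort h C

data Binds : Item → Term → Set where
  λ-binds : ∀ {W} → Binds (λI W) W
  δ-binds : ∀ {V} → Binds (δI V) V

kindCtx-binder : ∀ {b X} → Binds b X → ∀ C₁ C₂ →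
                 kindCtx (C₁ ·[ b ]· C₂) (binders C₂) ≡ kindOf (kindCtx C₁) X
kindCtx-binder {X = X} λ-binds C₁ (⋆E h) = cong (λ Γ → kindOf Γ X) (kindCtx-setSort h C₁)
kindCtx-binder {X = X} δ-binds C₁ (⋆E h) = cong (λ Γ → kindOf Γ X) (kindCtx-setSort h C₁)
kindCtx-binder b C₁ (C ∙ λI _)    = kindCtx-binder b C₁ C
kindCtx-binder b C₁ (C ∙ δI _)    = kindCtx-binder b C₁ C
kindCtx-binder b C₁ (C ∙ applI _) = kindCtx-binder b C₁ C
kindCtx-binder b C₁ (C ∙ castI _) = kindCtx-binder b C₁ C

kindCtx-outer : ∀ {b X} → Binds b X → ∀ C₁ C₂ j →
                kindCtx (C₁ ·[ b ]· C₂) (j + suc (binders C₂)) ≡ kindCtx C₁ j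
kindCtx-outer λ-binds C₁ (⋆E h) j rewrite +-comm j 1 = cong-app (kindCtx-setSort h C₁) j
kindCtx-outer δ-binds C₁ (⋆E h) j rewrite +-comm j 1 = cong-app (kindCtx-setSort h C₁) j
kindCtx-outer b C₁ (C ∙ λI _) j rewrite +-suc j (suc (binders C)) = kindCtx-outer b C₁ C j
kindCtx-outer b C₁ (C ∙ δI _) j rewrite +-suc j (suc (binders C)) = kindCtx-outer b C₁ C j
kindCtx-outer b C₁ (C ∙ applI _) = kindCtx-outer b C₁ C
kindCtx-outer b C₁ (C ∙ castI _) = kindCtx-outer b C₁ C

kindOf-lift : ∀ {b X} → Binds b X → ∀ C₁ C₂ W →
              kindOf (kindCtx (C₁ ·[ b ]· C₂)) (shift (suc (binders C₂)) 0 W) ≡ kindOf (kindCtx C₁) W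
kindOf-lift b C₁ C₂ W = trans (cong (kindOf _) (shift₀-ren (suc (binders C₂)) W))
                              (kindOf-ren _ (kindCtx-outer b C₁ C₂) W)

SameKind : KindCtx → Term → Term → Set
SameKind Γ T U = ∃ λ k → kindOf Γ T ≡ just k × kindOf Γ U ≡ just k

typed⇒sameKind : ∀ {g E T U} → E ⊢[ g ] T ∶ U → SameKind (kindCtx E) T U
typed⇒sameKind sortT = ι , refl , refl
typed⇒sameKind (defT {C₁ = C₁} {C₂ = C₂} {W} ⊢V) with typed⇒sameKind ⊢V
... | k , V∶k , W∶k =
  k , trans (kindCtx-binder δ-binds C₁ C₂) V∶k , trans (kindOf-lift δ-binds C₁ C₂ W) W∶k
typed⇒sameKind (declT {C₁ = C₁} {W} {C₂} ⊢W) with typed⇒sameKind ⊢W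
... | k , W∶k , _ =
  k , trans (kindCtx-binder λ-binds C₁ C₂) W∶k , trans (kindOf-lift λ-binds C₁ C₂ W) W∶k
typed⇒sameKind (abbrT ⊢V ⊢T) with typed⇒sameKind ⊢V | typed⇒sameKind ⊢T
... | _ , V∶a , _ | k , T∶k , U∶k = k , ≫⁺ V∶a T∶k , ≫⁺ V∶a U∶k
typed⇒sameKind (abstT ⊢W ⊢T) with typed⇒sameKind ⊢W | typed⇒sameKind ⊢T
... | a , W∶a , _ | b , T∶b , U∶b = a ⇾ b , arrowₖ⁺ W∶a T∶b , arrowₖ⁺ W∶a U∶b
typed⇒sameKind (applT ⊢V ⊢T) with typed⇒sameKind ⊢V | typed⇒sameKind ⊢T
... | a , V∶a , W∶a | k , T∶k , λWU∶k with arrowₖ⁻ λWU∶k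
...   | a' , b , W∶a' , _ , refl with just-injective (trans (sym W∶a) W∶a')
...     | refl = b , applyₖ⁺ V∶a T∶k , applyₖ⁺ V∶a λWU∶k
typed⇒sameKind (castT ⊢T ⊢W) with typed⇒sameKind ⊢T | typed⇒sameKind ⊢W
... | k , T∶k , W∶k | _ , _ , V∶a = k , ≫⁺ W∶k T∶k , ≫⁺ V∶a W∶k
typed⇒sameKind {E = E} (convT ⊢U₂ ⊢T U₁⇔U₂) with typed⇒sameKind ⊢U₂ | typed⇒sameKind ⊢T
... | k₂ , U₂∶k₂ , _ | k₁ , T∶k₁ , U₁∶k₁ with ⇔-kind E U₁⇔U₂ U₁∶k₁ U₂∶k₂
...   | refl = k₁ , T∶k₁ , U₂∶k₂

mainTheorem12 : (g : ℕ → ℕ) → (∀ h → h < g h) →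
    (C : Env) (V T U₁ U₂ : Term) →
    C ⊢[ g ] abst V T ∶ U₁ →
    (C ∙ λI V) ⊢[ g ] T ∶ shift 1 0 U₂ →
    ¬ (C ⊢ U₁ ⇔ U₂)
mainTheorem12 g _ C V T U₁ U₂ ⊢λVT ⊢T U₁⇔U₂ with typed⇒sameKind ⊢λVT | typed⇒sameKind ⊢T
... | k , λVT∶k , U₁∶k | b , T∶b , ↑U₂∶b with arrowₖ⁻ λVT∶k
...   | a , b' , _ , T∶b' , refl with just-injective (trans (sym T∶b') T∶b)
...     | refl = a⇾b≢b a b (⇔-kind C U₁⇔U₂ U₁∶k (trans (sym (kindOf-shift₁ U₂)) ↑U₂∶b))
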